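{- For every finite standard closure space $(U,\varphi)$ with lattice of closed sets $(\mathcal{C},\subseteq)$, there exists a finite standard closure space $(T,\psi)$ with lattice of closed sets $(\mathcal{F},\subseteq)$ such that $(\mathcal{C},\subseteq)$ is (isomorphic to) a sublattice of $(\mathcal{F},\subseteq)$ and the $E$-base of $(T,\psi)$ is valid.
   Context: A closure space $(U,\varphi)$: finite $U$ with closure operator $\varphi$ on $2^U$; closed sets form a lattice under inclusion (meet $\cap$, join $\varphi(C_1\cup C_2)$). Standard: $\varphi(\{x\})\setminus\{x\}$ closed for all $x\in U$. $\varphi^b(X)=\bigcup_{x\in X}\varphi(\{x\})$. $D$-generator of $x$: $A\subseteq U$ with $x\in\varphi(A)$, $x\notin\varphi^b(A)$, and $x\notin\varphi(B)$ for all $B$ with $\varphi^b(B)\subsetneq\varphi^b(A)$. $E$-generator of $x$: $D$-generator $A$ of $x$ with $\varphi(A)$ inclusion-minimal among closures of $D$-generators of $x$. $E$-base: $\Sigma_E=\{a\to x: x\neq a,x\in\varphi(\{a\})\}\cup\{A\to x: A \text{ an } E\text{ -generator of } x\}$. A set $\Sigma$ of implications $A\to X$ induces the closure operator whose closed sets $C$ satisfy $A\subseteq C\Rightarrow X\subseteq C$ for all $A\to X\in\Sigma$; the $E$-base is valid if this operator equals the space's closure operator. -}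

module Defs where

open import Data.Nat using (ℕ)
open import Data.Bool using (Bool; if_then_else_)
open import Data.Fin using (Fin)
open import Data.Fin.Subset using (Subset; ⁅_⁆; _∈_; _∉_; _⊆_; _⊂_; _∩_; _∪_; _-_; ⋃; ⊥)
open import Data.Vec using (lookup)
open import Data.List using (List; map; allFin)
open import Data.Product using (Σ; _×_; ∃; ∃-syntax)
open import Relation.Binary.PropositionalEquality using (_≡_)
open import Function.Bundles using (_⇔_)

record IsClosureOperator {n : ℕ} (φ : Subset n → Subset n) : Set where
  field
    extensive  : ∀ X → X ⊆ φ X
    monotone   : ∀ X Y → X ⊆ Y → φ X ⊆ φ Y
    idempotent : ∀ X → φ (φ X) ≡ φ X

Closed : {n : ℕ} → (Subset n → Subset n) → Subset n → Set
Closed φ C = φ C ≡ C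

IsStandard : {n : ℕ} → (Subset n → Subset n) → Set
IsStandard {n} φ = ∀ (x : Fin n) → Closed φ (φ ⁅ x ⁆ - x)

record StandardClosureSpace (n : ℕ) : Set where
  field
    cl         : Subset n → Subset n
    isClosure  : IsClosureOperator cl
    isStandard : IsStandard cl

φᵇ : {n : ℕ} → (Subset n → Subset n) → Subset n → Subset n
φᵇ {n} φ X = ⋃ (map (λ x → if lookup X x then φ ⁅ x ⁆ else ⊥) (allFin n))

IsDGenerator : {n : ℕ} → (Subset n → Subset n) → Subset n → Fin n → Set
IsDGenerator {n} φ A x =
  x ∈ φ A × x ∉ φᵇ φ A ×
  (∀ (B : Subset n) → φᵇ φ B ⊂ φᵇ φ A → x ∉ φ B)

IsEGenerator : {n : ℕ} → (Subset n → Subset n) → Subset n → Fin n → Set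
IsEGenerator {n} φ A x =
  IsDGenerator φ A x ×
  (∀ (A′ : Subset n) → IsDGenerator φ A′ x → φ A′ ⊆ φ A → φ A ⊆ φ A′)

-- Implications A → X as pairs (premise, conclusion).
Implication : ℕ → Set
Implication n = Subset n × Subset n

InEBase : {n : ℕ} → (Subset n → Subset n) → Subset n → Subset n → Set
InEBase {n} φ P Q =
  (Σ (Fin n) λ a → Σ (Fin n) λ x →
     (x ≡ a → Data.Empty.⊥) × x ∈ φ ⁅ a ⁆ × P ≡ ⁅ a ⁆ × Q ≡ ⁅ x ⁆)
  Data.Sum.⊎
  (Σ (Fin n) λ x → IsEGenerator φ P x × Q ≡ ⁅ x ⁆)
  where import Data.Empty; import Data.Sum

RespectsEBase : {n : ℕ} → (Subset n → Subset n) → Subset n → Set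
RespectsEBase {n} φ C = ∀ (P Q : Subset n) → InEBase φ P Q → P ⊆ C → Q ⊆ C

-- The E-base is valid: the closure operator it induces equals φ, i.e.
-- both operators have the same closed sets.
EBaseValid : {n : ℕ} → (Subset n → Subset n) → Set
EBaseValid {n} φ = ∀ (C : Subset n) → (Closed φ C ⇔ RespectsEBase φ C)

-- The lattice of closed sets of φ (meet ∩, join φ(C₁ ∪ C₂)) is isomorphic
-- to a sublattice of the lattice of closed sets of ψ: there is an injective
-- map from closed sets to closed sets preserving meets and joins.
record LatticeEmbedding {n m : ℕ} (φ : Subset n → Subset n) (ψ : Subset m → Subset m) : Set where
  field
    f           : Subset n → Subset m
    closed↦     : ∀ C → Closed φ C → Closed ψ (f C)
    injective   : ∀ C D → Closed φ C → Closed φ D → f C ≡ f D → C ≡ D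
    pres-meet   : ∀ C D → Closed φ C → Closed φ D → f (C ∩ D) ≡ f C ∩ f D
    pres-join   : ∀ C D → Closed φ C → Closed φ D → f (φ (C ∪ D)) ≡ ψ (f C ∪ f D)

{-# OPTIONS --safe #-}
-- Double the universe: every point x (as i ↑ˡ n) gets a copy x′ (as n ↑ʳ i), and ψ X
-- consists of the copies of all points touched by X together with those points of
-- φ (X ∩ U) that lie in X or have their copy in X.  Then C ↦ C ∪ U′ embeds the closed
-- sets of φ as a sublattice.  The closed sets of ψ are cut out by the implications
-- x → x′ and R ∪ {x′} → x, for R a minimal φ-generator of x with x ∉ R, and each such
-- R ∪ {x′} is an E-generator of x: the ψᵇ-closure of any set below it reaches only R,
-- their copies and x′, so minimality of R forces that set to contain R ∪ {x′}.
-- Standardness of φ gives φ ∅ = ∅, which makes every set of copies ψ-closed.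
module Submission where

open import Defs
open import Data.Bool using (true; false; if_then_else_; _∧_; _∨_)
open import Data.Empty using (⊥-elim)
open import Data.Fin using (Fin; zero; suc; _↑ˡ_; _↑ʳ_)
open import Data.Fin.Properties using (suc-injective; any?)
open import Data.Fin.Subset
  using (Subset; ⁅_⁆; _∈_; _∉_; _⊆_; _⊂_; _∩_; _∪_; _─_; _-_; ⋃; ⊥; ⊤; ∣_∣; inside; outside)
open import Data.Fin.Subset.Properties
  using ( ∉⊥; ⊆-min; ⊆-refl; ⊆-trans; ⊆-antisym; Empty-unique; _∈?_; x∈⁅x⁆; x∈⁅y⁆⇒x≡y
        ; x∈p∩q⁺; x∈p∩q⁻; x∈p∪q⁺; x∈p∪q⁻; ∩-idem; ∩-identityʳ; ∪-idem; ∪-zeroʳ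
        ; p─q⊆p; x∈p∧x≢y⇒x∈p-y; x∈p⇒∣p-x∣<∣p∣ )
open import Data.List using (List; []; _∷_; map; allFin)
open import Data.List.Membership.Propositional using (lose)
open import Data.List.Membership.Propositional.Properties using (∈-allFin)
open import Data.List.Relation.Unary.Any using (Any; here; there; satisfied)
open import Data.List.Relation.Unary.Any.Properties using (map⁺; map⁻)
open import Data.Nat using (ℕ; zero; suc; _+_; _<_)
open import Data.Nat.Induction using (<-wellFounded)
open import Data.Product using (Σ; _×_; _,_; proj₁; proj₂; ∃-syntax)
open import Data.Sum using (_⊎_; inj₁; inj₂; [_,_]′)
open import Data.Vec using ([]; _∷_; _++_; lookup; take; drop; here; there)
open import Data.Vec.Properties using ([]=⇒lookup; lookup⇒[]=; take++drop≡id; zipWith-++; ++-injectiveˡ)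
open import Function using (_∘_; id)
open import Function.Bundles using (mk⇔)
open import Induction.WellFounded using (Acc; acc)
open import Relation.Binary.PropositionalEquality
  using (_≡_; _≢_; refl; sym; trans; cong; cong₂; subst; module ≡-Reasoning)
open import Relation.Nullary using (yes; no)
open import Relation.Nullary.Decidable using (_×-dec_)

private
  variable
    m n : ℕ
    x : Fin n
    p : Subset n

x∈p─q⇒x∉q : ∀ (p q : Subset n) → x ∈ p ─ q → x ∉ q
x∈p─q⇒x∉q {x = zero}  (_ ∷ p) (inside  ∷ q) ()        _
x∈p─q⇒x∉q {x = zero}  (_ ∷ p) (outside ∷ q) _         ()
x∈p─q⇒x∉q {x = suc x} (_ ∷ p) (_       ∷ q) (there h) (there h′) = x∈p─q⇒x∉q p q h h′

x∈p-y⇒x≢y : ∀ {y} (p : Subset n) → x ∈ p - y → x ≢ y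
x∈p-y⇒x≢y {y = y} p h refl = x∈p─q⇒x∉q p ⁅ y ⁆ h (x∈⁅x⁆ y)

x∈p⇒⁅x⁆⊆p : x ∈ p → ⁅ x ⁆ ⊆ p
x∈p⇒⁅x⁆⊆p {x = x} {p = p} x∈p y∈⁅x⁆ = subst (_∈ p) (sym (x∈⁅y⁆⇒x≡y x y∈⁅x⁆)) x∈p

x∈⋃⁻ : ∀ (ps : List (Subset n)) → x ∈ ⋃ ps → Any (x ∈_) ps
x∈⋃⁻ []       x∈ = ⊥-elim (∉⊥ x∈)
x∈⋃⁻ (p ∷ ps) x∈ with x∈p∪q⁻ p (⋃ ps) x∈
... | inj₁ x∈p  = here x∈p
... | inj₂ x∈ps = there (x∈⋃⁻ ps x∈ps)

x∈⋃⁺ : ∀ {ps : List (Subset n)} → Any (x ∈_) ps → x ∈ ⋃ ps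
x∈⋃⁺ (here x∈p)   = x∈p∪q⁺ (inj₁ x∈p)
x∈⋃⁺ (there x∈ps) = x∈p∪q⁺ (inj₂ (x∈⋃⁺ x∈ps))

module _ (φ : Subset n → Subset n) where

  private
    contribution : Subset n → Fin n → Subset n
    contribution X i = if lookup X i then φ ⁅ i ⁆ else ⊥

  ∈φᵇ⁻ : ∀ X → x ∈ φᵇ φ X → ∃[ i ] i ∈ X × x ∈ φ ⁅ i ⁆
  ∈φᵇ⁻ {x = x} X x∈ =
    let i , x∈i = satisfied (map⁻ {f = contribution X} (x∈⋃⁻ (map (contribution X) (allFin _)) x∈))
    in  i , contributing i x∈i
    where
    contributing : ∀ i → x ∈ contribution X i → i ∈ X × x ∈ φ ⁅ i ⁆
    contributing i x∈i with lookup X i in eq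
    ... | true  = lookup⇒[]= i X eq , x∈i
    ... | false = ⊥-elim (∉⊥ x∈i)

  ∈φᵇ⁺ : ∀ X {i} → i ∈ X → x ∈ φ ⁅ i ⁆ → x ∈ φᵇ φ X
  ∈φᵇ⁺ {x = x} X {i} i∈X x∈ = x∈⋃⁺ (map⁺ (lose (∈-allFin i) contributing))
    where
    contributing : x ∈ contribution X i
    contributing rewrite []=⇒lookup i∈X = x∈

  φᵇ-mono : ∀ {X Y} → X ⊆ Y → φᵇ φ X ⊆ φᵇ φ Y
  φᵇ-mono {X} {Y} X⊆Y x∈ = let i , i∈X , x∈i = ∈φᵇ⁻ X x∈ in ∈φᵇ⁺ Y (X⊆Y i∈X) x∈i

InEBase⇒⊆φ : ∀ {φ : Subset n → Subset n} {P Q} → InEBase φ P Q → Q ⊆ φ P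
InEBase⇒⊆φ (inj₁ (_ , _ , _ , x∈φa , refl , refl)) = x∈p⇒⁅x⁆⊆p x∈φa
InEBase⇒⊆φ (inj₂ (_ , ((x∈φP , _) , _) , refl))    = x∈p⇒⁅x⁆⊆p x∈φP

module ClosureOperatorProperties {φ : Subset n → Subset n} (isClosure : IsClosureOperator φ) where
  open IsClosureOperator isClosure

  ⊆⇒closed : ∀ {Y} → φ Y ⊆ Y → Closed φ Y
  ⊆⇒closed {Y} φY⊆Y = ⊆-antisym φY⊆Y (extensive Y)

  φ-least : ∀ {X C} → Closed φ C → X ⊆ C → φ X ⊆ C
  φ-least {X} {C} closed X⊆C = subst (φ X ⊆_) closed (monotone X C X⊆C)

  ⊆φ⇒φ⊆φ : ∀ {X Y} → X ⊆ φ Y → φ X ⊆ φ Y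
  ⊆φ⇒φ⊆φ {Y = Y} = φ-least (idempotent Y)

  p⊆φᵇp : ∀ X → X ⊆ φᵇ φ X
  p⊆φᵇp X {i} i∈X = ∈φᵇ⁺ φ X i∈X (extensive ⁅ i ⁆ (x∈⁅x⁆ i))

  x∉φ⊥ : IsStandard φ → x ∉ φ ⊥
  x∉φ⊥ {x} standard x∈ = x∈p-y⇒x≢y (φ ⁅ x ⁆) (φ-least (standard x) (⊆-min _) x∈) refl

  closed⇒respectsEBase : ∀ {C} → Closed φ C → RespectsEBase φ C
  closed⇒respectsEBase closed _ _ e P⊆C = ⊆-trans (InEBase⇒⊆φ e) (φ-least closed P⊆C)

MinimalGenerator : (Subset n → Subset n) → Fin n → Subset n → Set
MinimalGenerator φ x R = x ∈ φ R × (∀ {i} → i ∈ R → x ∉ φ (R - i))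

module _ {φ : Subset n → Subset n} where

  minimalGenerator-least : (∀ X Y → X ⊆ Y → φ X ⊆ φ Y) → ∀ {R B} →
                           MinimalGenerator φ x R → B ⊆ R → x ∈ φ B → R ⊆ B
  minimalGenerator-least monotone {R} {B} (_ , minimal) B⊆R x∈φB {k} k∈R with k ∈? B
  ... | yes k∈B = k∈B
  ... | no  k∉B = ⊥-elim (minimal k∈R (monotone B (R - k) B⊆R-k x∈φB))
    where
    B⊆R-k : B ⊆ R - k
    B⊆R-k y∈B = x∈p∧x≢y⇒x∈p-y (B⊆R y∈B) λ { refl → k∉B y∈B }

  minimalGenerator-exists : ∀ M → x ∈ φ M → ∃[ R ] R ⊆ M × MinimalGenerator φ x R
  minimalGenerator-exists M = shrink M (<-wellFounded ∣ M ∣)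
    where
    shrink : ∀ M → Acc _<_ ∣ M ∣ → x ∈ φ M → ∃[ R ] R ⊆ M × MinimalGenerator φ x R
    shrink M (acc smaller) x∈φM with any? (λ i → i ∈? M ×-dec _ ∈? φ (M - i))
    ... | yes (i , i∈M , x∈φM-i) =
      let R , R⊆M-i , minimal = shrink (M - i) (smaller (x∈p⇒∣p-x∣<∣p∣ i∈M)) x∈φM-i
      in  R , p─q⊆p M ⁅ i ⁆ ∘ R⊆M-i , minimal
    ... | no  irreducible = M , ⊆-refl , x∈φM , λ i∈M x∈ → irreducible (_ , i∈M , x∈)

data Split (m n : ℕ) : Fin (m + n) → Set where
  left  : (i : Fin m) → Split m n (i ↑ˡ n)
  right : (j : Fin n) → Split m n (m ↑ʳ j)

split : ∀ m {n} (k : Fin (m + n)) → Split m n k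
split zero    j       = right j
split (suc m) zero    = left zero
split (suc m) (suc k) with split m k
... | left i  = left (suc i)
... | right j = right j

↑ˡ≢↑ʳ : ∀ (i : Fin m) (j : Fin n) → i ↑ˡ n ≢ m ↑ʳ j
↑ˡ≢↑ʳ zero    j ()
↑ˡ≢↑ʳ (suc i) j eq = ↑ˡ≢↑ʳ i j (suc-injective eq)

↑ˡ∈++⁺ : ∀ {A : Subset m} {B : Subset n} {i} → i ∈ A → i ↑ˡ n ∈ A ++ B
↑ˡ∈++⁺ here        = here
↑ˡ∈++⁺ (there i∈A) = there (↑ˡ∈++⁺ i∈A)

↑ˡ∈++⁻ : ∀ (A : Subset m) {B : Subset n} {i} → i ↑ˡ n ∈ A ++ B → i ∈ A
↑ˡ∈++⁻ (_ ∷ _) {i = zero}  here       = here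
↑ˡ∈++⁻ (_ ∷ A) {i = suc i} (there i∈) = there (↑ˡ∈++⁻ A i∈)

↑ʳ∈++⁺ : ∀ (A : Subset m) {B : Subset n} {j} → j ∈ B → m ↑ʳ j ∈ A ++ B
↑ʳ∈++⁺ []      j∈B = j∈B
↑ʳ∈++⁺ (_ ∷ A) j∈B = there (↑ʳ∈++⁺ A j∈B)

↑ʳ∈++⁻ : ∀ (A : Subset m) {B : Subset n} {j} → m ↑ʳ j ∈ A ++ B → j ∈ B
↑ʳ∈++⁻ []      j∈         = j∈
↑ʳ∈++⁻ (_ ∷ A) (there j∈) = ↑ʳ∈++⁻ A j∈

module _ {m n : ℕ} where

  lefts : Subset (m + n) → Subset m
  lefts = take m

  rights : Subset (m + n) → Subset n
  rights = drop m

  ∈lefts⁺ : ∀ {X i} → i ↑ˡ n ∈ X → i ∈ lefts X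
  ∈lefts⁺ {X} i∈ = ↑ˡ∈++⁻ (lefts X) (subst (_ ∈_) (sym (take++drop≡id m X)) i∈)

  ∈lefts⁻ : ∀ {X i} → i ∈ lefts X → i ↑ˡ n ∈ X
  ∈lefts⁻ {X} i∈ = subst (_ ∈_) (take++drop≡id m X) (↑ˡ∈++⁺ i∈)

  ∈rights⁺ : ∀ {X j} → m ↑ʳ j ∈ X → j ∈ rights X
  ∈rights⁺ {X} j∈ = ↑ʳ∈++⁻ (lefts X) (subst (_ ∈_) (sym (take++drop≡id m X)) j∈)

  ∈rights⁻ : ∀ {X j} → j ∈ rights X → m ↑ʳ j ∈ X
  ∈rights⁻ {X} j∈ = subst (_ ∈_) (take++drop≡id m X) (↑ʳ∈++⁺ (lefts X) j∈)

  lefts-mono : ∀ {X Y} → X ⊆ Y → lefts X ⊆ lefts Y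
  lefts-mono X⊆Y = ∈lefts⁺ ∘ X⊆Y ∘ ∈lefts⁻

  split-⊆ : ∀ {X Y : Subset (m + n)} →
            (∀ {i} → i ↑ˡ n ∈ X → i ↑ˡ n ∈ Y) →
            (∀ {j} → m ↑ʳ j ∈ X → m ↑ʳ j ∈ Y) → X ⊆ Y
  split-⊆ onLeft onRight {k} with split m k
  ... | left  i = onLeft
  ... | right j = onRight

  ++-⊆ : ∀ {A B X} → A ⊆ lefts X → B ⊆ rights X → A ++ B ⊆ X
  ++-⊆ {A} A⊆ B⊆ = split-⊆ (∈lefts⁻ ∘ A⊆ ∘ ↑ˡ∈++⁻ A) (∈rights⁻ ∘ B⊆ ∘ ↑ʳ∈++⁻ A)

lefts-++ : ∀ (A : Subset m) (B : Subset n) → lefts (A ++ B) ≡ A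
lefts-++ []      B = refl
lefts-++ (a ∷ A) B = cong (a ∷_) (lefts-++ A B)

rights-++ : ∀ (A : Subset m) (B : Subset n) → rights (A ++ B) ≡ B
rights-++ []      B = refl
rights-++ (_ ∷ A) B = rights-++ A B

lefts⁅↑ʳ⁆ : ∀ m {n} (j : Fin n) → lefts {m} ⁅ m ↑ʳ j ⁆ ≡ ⊥
lefts⁅↑ʳ⁆ zero    j = refl
lefts⁅↑ʳ⁆ (suc m) j = cong (outside ∷_) (lefts⁅↑ʳ⁆ m j)

module Doubling (S : StandardClosureSpace n) where
  open StandardClosureSpace S renaming (cl to φ)
  open IsClosureOperator isClosure
  open ClosureOperatorProperties isClosure

  support : Subset (n + n) → Subset n
  support X = lefts X ∪ rights X

  ψ : Subset (n + n) → Subset (n + n)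
  ψ X = (φ (lefts X) ∩ support X) ++ support X

  ∈support⁺ˡ : ∀ {X i} → i ↑ˡ n ∈ X → i ∈ support X
  ∈support⁺ˡ i∈ = x∈p∪q⁺ (inj₁ (∈lefts⁺ i∈))

  ∈support⁺ʳ : ∀ {X i} → n ↑ʳ i ∈ X → i ∈ support X
  ∈support⁺ʳ i∈ = x∈p∪q⁺ (inj₂ (∈rights⁺ i∈))

  ∈support⁻ : ∀ {X i} → i ∈ support X → i ↑ˡ n ∈ X ⊎ n ↑ʳ i ∈ X
  ∈support⁻ {X} i∈ = [ inj₁ ∘ ∈lefts⁻ , inj₂ ∘ ∈rights⁻ ]′ (x∈p∪q⁻ (lefts X) (rights X) i∈)

  support-mono : ∀ {X Y} → X ⊆ Y → support X ⊆ support Y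
  support-mono X⊆Y = [ ∈support⁺ˡ ∘ X⊆Y , ∈support⁺ʳ ∘ X⊆Y ]′ ∘ ∈support⁻

  ↑ˡ∈ψ⁺ : ∀ {X i} → i ∈ φ (lefts X) → i ∈ support X → i ↑ˡ n ∈ ψ X
  ↑ˡ∈ψ⁺ i∈φ i∈supp = ↑ˡ∈++⁺ (x∈p∩q⁺ (i∈φ , i∈supp))

  ↑ˡ∈ψ⁻ : ∀ {X i} → i ↑ˡ n ∈ ψ X → i ∈ φ (lefts X) × i ∈ support X
  ↑ˡ∈ψ⁻ {X} i∈ = x∈p∩q⁻ _ _ (↑ˡ∈++⁻ (φ (lefts X) ∩ support X) i∈)

  ↑ʳ∈ψ⁺ : ∀ {X i} → i ∈ support X → n ↑ʳ i ∈ ψ X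
  ↑ʳ∈ψ⁺ {X} = ↑ʳ∈++⁺ (φ (lefts X) ∩ support X)

  ↑ʳ∈ψ⁻ : ∀ {X i} → n ↑ʳ i ∈ ψ X → i ∈ support X
  ↑ʳ∈ψ⁻ {X} = ↑ʳ∈++⁻ (φ (lefts X) ∩ support X)

  ψ⊆ψ : ∀ {X Y} → lefts X ⊆ φ (lefts Y) → support X ⊆ support Y → ψ X ⊆ ψ Y
  ψ⊆ψ lefts⊆ support⊆ = split-⊆
    (λ i∈ → let i∈φ , i∈supp = ↑ˡ∈ψ⁻ i∈ in ↑ˡ∈ψ⁺ (⊆φ⇒φ⊆φ lefts⊆ i∈φ) (support⊆ i∈supp))
    (↑ʳ∈ψ⁺ ∘ support⊆ ∘ ↑ʳ∈ψ⁻)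

  ψ-extensive : ∀ X → X ⊆ ψ X
  ψ-extensive X = split-⊆
    (λ i∈ → ↑ˡ∈ψ⁺ (extensive (lefts X) (∈lefts⁺ i∈)) (∈support⁺ˡ i∈))
    (↑ʳ∈ψ⁺ ∘ ∈support⁺ʳ)

  ψ-monotone : ∀ X Y → X ⊆ Y → ψ X ⊆ ψ Y
  ψ-monotone X Y X⊆Y = ψ⊆ψ (extensive (lefts Y) ∘ lefts-mono X⊆Y) (support-mono X⊆Y)

  ψ-idempotent : ∀ X → ψ (ψ X) ≡ ψ X
  ψ-idempotent X = ⊆-antisym
    (ψ⊆ψ (proj₁ ∘ ↑ˡ∈ψ⁻ ∘ ∈lefts⁻) ([ proj₂ ∘ ↑ˡ∈ψ⁻ , ↑ʳ∈ψ⁻ ]′ ∘ ∈support⁻))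
    (ψ-extensive (ψ X))

  ψ-isClosureOperator : IsClosureOperator ψ
  ψ-isClosureOperator = record
    { extensive = ψ-extensive ; monotone = ψ-monotone ; idempotent = ψ-idempotent }

  private
    module Ψ = ClosureOperatorProperties ψ-isClosureOperator

  ↑ˡ∉ψ : ∀ {X i} → lefts X ≡ ⊥ → i ↑ˡ n ∉ ψ X
  ↑ˡ∉ψ {X} {i} noLefts i∈ =
    x∉φ⊥ isStandard (subst (λ L → i ∈ φ L) noLefts (proj₁ (↑ˡ∈ψ⁻ i∈)))

  ↑ˡ∈ψ⁅⁆ : ∀ {k i} → i ↑ˡ n ∈ ψ ⁅ k ⁆ → k ≡ i ↑ˡ n
  ↑ˡ∈ψ⁅⁆ {k} {i} i∈ with ∈support⁻ (proj₂ (↑ˡ∈ψ⁻ i∈))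
  ... | inj₁ i∈⁅k⁆ = sym (x∈⁅y⁆⇒x≡y k i∈⁅k⁆)
  ... | inj₂ i′∈⁅k⁆ with x∈⁅y⁆⇒x≡y k i′∈⁅k⁆
  ...   | refl = ⊥-elim (↑ˡ∉ψ (lefts⁅↑ʳ⁆ n i) i∈)

  copies-closed : ∀ {Y} → lefts Y ≡ ⊥ → Closed ψ Y
  copies-closed {Y} noLefts = Ψ.⊆⇒closed (split-⊆ (⊥-elim ∘ ↑ˡ∉ψ noLefts) copy)
    where
    copy : ∀ {j} → n ↑ʳ j ∈ ψ Y → n ↑ʳ j ∈ Y
    copy {j} j′∈ = [ (λ j∈ → ⊥-elim (∉⊥ (subst (j ∈_) noLefts (∈lefts⁺ j∈)))) , id ]′
                     (∈support⁻ (↑ʳ∈ψ⁻ j′∈))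

  ψ-isStandard : IsStandard ψ
  ψ-isStandard x = copies-closed (Empty-unique λ (i , i∈) →
    let i∈ψ⁅x⁆-x = ∈lefts⁻ i∈
    in  x∈p-y⇒x≢y (ψ ⁅ x ⁆) i∈ψ⁅x⁆-x (sym (↑ˡ∈ψ⁅⁆ (p─q⊆p (ψ ⁅ x ⁆) ⁅ x ⁆ i∈ψ⁅x⁆-x))))

  doubled : StandardClosureSpace (n + n)
  doubled = record { cl = ψ ; isClosure = ψ-isClosureOperator ; isStandard = ψ-isStandard }

  embed : Subset n → Subset (n + n)
  embed C = C ++ ⊤

  ψ-embed : ∀ C → ψ (embed C) ≡ embed (φ C)
  ψ-embed C = begin
    ψ (C ++ ⊤)                  ≡⟨ cong₂ (λ L R → (φ L ∩ (L ∪ R)) ++ (L ∪ R))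
                                         (lefts-++ C ⊤) (rights-++ C ⊤) ⟩
    (φ C ∩ (C ∪ ⊤)) ++ (C ∪ ⊤)  ≡⟨ cong (λ U → (φ C ∩ U) ++ U) (∪-zeroʳ C) ⟩
    (φ C ∩ ⊤) ++ ⊤              ≡⟨ cong (_++ ⊤) (∩-identityʳ (φ C)) ⟩
    φ C ++ ⊤                    ∎
    where open ≡-Reasoning

  embed-∩ : ∀ C D → embed (C ∩ D) ≡ embed C ∩ embed D
  embed-∩ C D = begin
    (C ∩ D) ++ ⊤        ≡⟨ cong ((C ∩ D) ++_) (∩-idem ⊤) ⟨
    (C ∩ D) ++ (⊤ ∩ ⊤)  ≡⟨ zipWith-++ _∧_ C ⊤ D ⊤ ⟨
    (C ++ ⊤) ∩ (D ++ ⊤) ∎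
    where open ≡-Reasoning

  embed-∪ : ∀ C D → embed (C ∪ D) ≡ embed C ∪ embed D
  embed-∪ C D = begin
    (C ∪ D) ++ ⊤        ≡⟨ cong ((C ∪ D) ++_) (∪-idem ⊤) ⟨
    (C ∪ D) ++ (⊤ ∪ ⊤)  ≡⟨ zipWith-++ _∨_ C ⊤ D ⊤ ⟨
    (C ++ ⊤) ∪ (D ++ ⊤) ∎
    where open ≡-Reasoning

  embed-join : ∀ C D → embed (φ (C ∪ D)) ≡ ψ (embed C ∪ embed D)
  embed-join C D = begin
    embed (φ (C ∪ D))       ≡⟨ ψ-embed (C ∪ D) ⟨
    ψ (embed (C ∪ D))       ≡⟨ cong ψ (embed-∪ C D) ⟩
    ψ (embed C ∪ embed D)   ∎
    where open ≡-Reasoning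

  embedding : LatticeEmbedding φ ψ
  embedding = record
    { f         = embed
    ; closed↦   = λ C closed → trans (ψ-embed C) (cong embed closed)
    ; injective = λ C D _ _ → ++-injectiveˡ C D
    ; pres-meet = λ C D _ _ → embed-∩ C D
    ; pres-join = λ C D _ _ → embed-join C D
    }

  module EGenerator {j : Fin n} {R : Subset n} (j∉R : j ∉ R) (minimal : MinimalGenerator φ j R) where

    P : Subset (n + n)
    P = R ++ ⁅ j ⁆

    ↑ˡ∈ψᵇP⇒∈R : ∀ {i} → i ↑ˡ n ∈ φᵇ ψ P → i ∈ R
    ↑ˡ∈ψᵇP⇒∈R i∈ with ∈φᵇ⁻ ψ P i∈
    ... | k , k∈P , i∈ψ⁅k⁆ with ↑ˡ∈ψ⁅⁆ i∈ψ⁅k⁆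
    ...   | refl = ↑ˡ∈++⁻ R k∈P

    ↑ʳ∈P⇒≡ : ∀ {k} → n ↑ʳ k ∈ P → k ≡ j
    ↑ʳ∈P⇒≡ k′∈P = x∈⁅y⁆⇒x≡y j (↑ʳ∈++⁻ R k′∈P)

    P⊆ : ∀ {Q} → lefts Q ⊆ R → j ∉ lefts Q → j ↑ˡ n ∈ ψ Q → P ⊆ Q
    P⊆ {Q} lefts⊆R j∉lefts j∈ψQ =
      ++-⊆ (minimalGenerator-least monotone minimal lefts⊆R j∈φ) (x∈p⇒⁅x⁆⊆p j∈rights)
      where
      j∈φ : j ∈ φ (lefts Q)
      j∈φ = proj₁ (↑ˡ∈ψ⁻ j∈ψQ)
      j∈rights : j ∈ rights Q
      j∈rights = [ ⊥-elim ∘ j∉lefts ∘ ∈lefts⁺ , ∈rights⁺ ]′ (∈support⁻ (proj₂ (↑ˡ∈ψ⁻ j∈ψQ)))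

    generates : j ↑ˡ n ∈ ψ P
    generates = ↑ˡ∈ψ⁺ (subst (λ L → j ∈ φ L) (sym (lefts-++ R ⁅ j ⁆)) (proj₁ minimal))
                      (∈support⁺ʳ (↑ʳ∈++⁺ R (x∈⁅x⁆ j)))

    isDGenerator : IsDGenerator ψ P (j ↑ˡ n)
    isDGenerator = generates , j∉R ∘ ↑ˡ∈ψᵇP⇒∈R , ψᵇ-minimal
      where
      ψᵇ-minimal : ∀ B → φᵇ ψ B ⊂ φᵇ ψ P → j ↑ˡ n ∉ ψ B
      ψᵇ-minimal B (ψᵇB⊆ψᵇP , _ , y∈ψᵇP , y∉ψᵇB) j∈ψB =
        y∉ψᵇB (φᵇ-mono ψ (P⊆ lefts⊆R (j∉R ∘ lefts⊆R) j∈ψB) y∈ψᵇP)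
        where
        lefts⊆R : lefts B ⊆ R
        lefts⊆R = ↑ˡ∈ψᵇP⇒∈R ∘ ψᵇB⊆ψᵇP ∘ Ψ.p⊆φᵇp B ∘ ∈lefts⁻

    isEGenerator : IsEGenerator ψ P (j ↑ˡ n)
    isEGenerator = isDGenerator , closure-minimal
      where
      closure-minimal : ∀ P′ → IsDGenerator ψ P′ (j ↑ˡ n) → ψ P′ ⊆ ψ P → ψ P ⊆ ψ P′
      closure-minimal P′ (j∈ψP′ , j∉ψᵇP′ , _) ψP′⊆ψP =
        ψ-monotone P P′ (P⊆ lefts⊆R j∉lefts j∈ψP′)
        where
        j∉lefts : j ∉ lefts P′
        j∉lefts = j∉ψᵇP′ ∘ Ψ.p⊆φᵇp P′ ∘ ∈lefts⁻
        lefts⊆R : lefts P′ ⊆ R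
        lefts⊆R k∈ with ∈support⁻ (proj₂ (↑ˡ∈ψ⁻ (ψP′⊆ψP (ψ-extensive P′ (∈lefts⁻ k∈)))))
        ... | inj₁ k∈P  = ↑ˡ∈++⁻ R k∈P
        ... | inj₂ k′∈P with ↑ʳ∈P⇒≡ k′∈P
        ...   | refl = ⊥-elim (j∉lefts k∈)

  respectsEBase⇒closed : ∀ {Z} → RespectsEBase ψ Z → Closed ψ Z
  respectsEBase⇒closed {Z} respects = Ψ.⊆⇒closed (split-⊆ original copy)
    where
    infer : ∀ {P x} → InEBase ψ P ⁅ x ⁆ → P ⊆ Z → x ∈ Z
    infer e P⊆Z = respects _ _ e P⊆Z (x∈⁅x⁆ _)

    copy-of : ∀ {i} → i ↑ˡ n ∈ Z → n ↑ʳ i ∈ Z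
    copy-of {i} i∈Z = infer
      (inj₁ (i ↑ˡ n , n ↑ʳ i , ↑ˡ≢↑ʳ i i ∘ sym ,
             ↑ʳ∈ψ⁺ (∈support⁺ˡ (x∈⁅x⁆ (i ↑ˡ n))) , refl , refl))
      (x∈p⇒⁅x⁆⊆p i∈Z)

    copy : ∀ {i} → n ↑ʳ i ∈ ψ Z → n ↑ʳ i ∈ Z
    copy i′∈ψZ = [ copy-of , id ]′ (∈support⁻ (↑ʳ∈ψ⁻ i′∈ψZ))

    original : ∀ {i} → i ↑ˡ n ∈ ψ Z → i ↑ˡ n ∈ Z
    original {i} i∈ψZ with i ↑ˡ n ∈? Z | minimalGenerator-exists (lefts Z) (proj₁ (↑ˡ∈ψ⁻ i∈ψZ))
    ... | yes i∈Z | _ = i∈Z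
    ... | no  i∉Z | R , R⊆lefts , minimal =
      infer (inj₂ (i ↑ˡ n , EGenerator.isEGenerator i∉R minimal , refl))
            (++-⊆ R⊆lefts (x∈p⇒⁅x⁆⊆p i∈rights))
      where
      i∉R : i ∉ R
      i∉R = i∉Z ∘ ∈lefts⁻ ∘ R⊆lefts
      i∈rights : i ∈ rights Z
      i∈rights = [ ⊥-elim ∘ i∉Z , ∈rights⁺ ]′ (∈support⁻ (proj₂ (↑ˡ∈ψ⁻ i∈ψZ)))

  ψ-EBaseValid : EBaseValid ψ
  ψ-EBaseValid _ = mk⇔ Ψ.closed⇒respectsEBase respectsEBase⇒closed

theorem4 : (n : ℕ) (S : StandardClosureSpace n) →
    Σ ℕ λ m → Σ (StandardClosureSpace m) λ T →
      LatticeEmbedding (StandardClosureSpace.cl S) (StandardClosureSpace.cl T)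
      × EBaseValid (StandardClosureSpace.cl T)
theorem4 n S = n + n , doubled , embedding , ψ-EBaseValid
  where open Doubling S
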